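{- Let $(A,\to,1)$ be an algebra of type $(2,0)$ satisfying (Re), (M), (B) and (An). Then (Ex) $\Leftrightarrow$ (BB).
   Context: Properties, for all $x,y,z\in A$: (Re) $x\to x=1$; (M) $1\to x=x$; (B) $(y\to z)\to[(x\to y)\to(x\to z)]=1$; (An) $x\to y=1=y\to x\Rightarrow x=y$; (Ex) $x\to(y\to z)=y\to(x\to z)$; (BB) $(y\to z)\to[(z\to x)\to(y\to x)]=1$. -}

module Defs where

open import Level using (Level)
open import Relation.Binary.PropositionalEquality using (_≡_)

module _ {a : Level} {A : Set a} (_⇒_ : A → A → A) (𝟏 : A) where

  Re : Set a
  Re = ∀ x → (x ⇒ x) ≡ 𝟏

  M : Set a
  M = ∀ x → (𝟏 ⇒ x) ≡ x

  B : Set a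
  B = ∀ x y z → ((y ⇒ z) ⇒ ((x ⇒ y) ⇒ (x ⇒ z))) ≡ 𝟏

  An : Set a
  An = ∀ x y → (x ⇒ y) ≡ 𝟏 → (y ⇒ x) ≡ 𝟏 → x ≡ y

  Ex : Set a
  Ex = ∀ x y z → (x ⇒ (y ⇒ z)) ≡ (y ⇒ (x ⇒ z))

  BB : Set a
  BB = ∀ x y z → ((y ⇒ z) ⇒ ((z ⇒ x) ⇒ (y ⇒ x))) ≡ 𝟏

module Submission where

-- Write x ≤ y for x → y = 1. With (M), axiom (B) makes ≤ transitive, and (BB) makes
-- every map (_ → c) antitone; together they give z ≤ (z → x) → x. Exchange then holds
-- up to ≤ in both directions, and (An) turns the two inequalities into an equality.
-- The converse is immediate: (Ex) rearranges (BB) into an instance of (B).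

open import Defs
open import Level using (Level)
open import Data.Product using (_×_; _,_)
open import Relation.Binary.PropositionalEquality using (_≡_; sym; trans; cong; subst₂)

module _ {a : Level} {A : Set a} (_⇒_ : A → A → A) (𝟏 : A) where

  _≤_ : A → A → Set a
  x ≤ y = (x ⇒ y) ≡ 𝟏

  ≤-mp : M _⇒_ 𝟏 → ∀ {x y} → x ≤ y → x ≡ 𝟏 → y ≡ 𝟏
  ≤-mp m {x} {y} x≤y x≡𝟏 = trans (sym (m y)) (trans (cong (_⇒ y) (sym x≡𝟏)) x≤y)

  ≤-trans : M _⇒_ 𝟏 → B _⇒_ 𝟏 → ∀ {x y z} → x ≤ y → y ≤ z → x ≤ z
  ≤-trans m b {x} {y} {z} x≤y y≤z = ≤-mp m (≤-mp m (b x y z) y≤z) x≤y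

  Ex⇒BB : B _⇒_ 𝟏 → Ex _⇒_ 𝟏 → BB _⇒_ 𝟏
  Ex⇒BB b ex x y z = trans (ex (y ⇒ z) (z ⇒ x) (y ⇒ x)) (b y z x)

  module _ (m : M _⇒_ 𝟏) (bb : BB _⇒_ 𝟏) where

    ⇒-antitoneˡ : ∀ {x y} c → x ≤ y → (y ⇒ c) ≤ (x ⇒ c)
    ⇒-antitoneˡ {x} {y} c x≤y = ≤-mp m (bb c x y) x≤y

    ≤-⇒-⇒ : ∀ z x → z ≤ ((z ⇒ x) ⇒ x)
    ≤-⇒-⇒ z x = subst₂ (λ u v → (u ⇒ ((z ⇒ x) ⇒ v)) ≡ 𝟏) (m z) (m x) (bb x 𝟏 z)

    module _ (b : B _⇒_ 𝟏) where

      ≤-exchange : ∀ {p q} c → p ≤ (q ⇒ c) → q ≤ (p ⇒ c)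
      ≤-exchange {p} {q} c p≤q⇒c = ≤-trans m b (≤-⇒-⇒ q c) (⇒-antitoneˡ c p≤q⇒c)

      exchange-≤ : ∀ x y z → (x ⇒ (y ⇒ z)) ≤ (y ⇒ (x ⇒ z))
      exchange-≤ x y z = ≤-exchange (x ⇒ z) (≤-trans m b (≤-⇒-⇒ y z) (b x (y ⇒ z) z))

      BB⇒Ex : An _⇒_ 𝟏 → Ex _⇒_ 𝟏
      BB⇒Ex an x y z = an _ _ (exchange-≤ x y z) (exchange-≤ y x z)

theorem2p4 : {a : Level} {A : Set a} (_⇒_ : A → A → A) (𝟏 : A) → Re _⇒_ 𝟏 → M _⇒_ 𝟏 → B _⇒_ 𝟏 → An _⇒_ 𝟏 → ((Ex _⇒_ 𝟏 → BB _⇒_ 𝟏) × (BB _⇒_ 𝟏 → Ex _⇒_ 𝟏))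
theorem2p4 _⇒_ 𝟏 _ m b an = Ex⇒BB _⇒_ 𝟏 b , λ bb → BB⇒Ex _⇒_ 𝟏 m bb b an
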